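{- In the Lie algebra of type $B_r$ with $r\ge 3$, let $\ell$ be an odd positive integer and $k$ a nonnegative integer with $\ell-1-4k\ge 0$. Then $\left|\mathcal{A}(\ell\varpi_1,(\ell-1-4k)\varpi_1+2k\varpi_2)\right|=F_{r+1}$, where $F_n$ is the $n$-th Fibonacci number ($F_1=F_2=1$, $F_n=F_{n-1}+F_{n-2}$ for $n\ge 3$).
   Context: Type $B_r$ in $\mathbb{R}^r$: simple roots $\alpha_i=\varepsilon_i-\varepsilon_{i+1}$ ($i<r$), $\alpha_r=\varepsilon_r$; positive roots $\varepsilon_i\pm\varepsilon_j$ ($i<j$), $\varepsilon_i$. Fundamental weights $\varpi_i=\varepsilon_1+\cdots+\varepsilon_i$ ($i<r$), $\varpi_r=\frac12(\varepsilon_1+\cdots+\varepsilon_r)$; $\rho=\varpi_1+\cdots+\varpi_r$. $W$ is the Weyl group generated by simple reflections $s_1,\dots,s_r$. Kostant's partition function $\wp(\xi)$ counts the ways to write $\xi$ as a nonnegative integral combination of positive roots; $\mathcal{A}(\lambda,\mu)=\{\sigma\in W:\wp(\sigma(\lambda+\rho)-(\mu+\rho))>0\}$. -}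

module Defs where

open import Data.Nat as ℕ using (ℕ; zero; suc)
open import Data.Integer as ℤ using (ℤ; +_; _+_; _-_; _*_; -_)
open import Data.Fin as Fin using (Fin; toℕ)
open import Data.Bool using (Bool; true; false; if_then_else_)
open import Data.Vec using (Vec; lookup)
open import Data.List using (List; []; _∷_; foldr; length)
open import Data.List.Membership.Propositional using (_∈_)
open import Data.List.Relation.Unary.Unique.Propositional using (Unique)
open import Data.Product using (Σ; ∃; _×_)
open import Function.Bundles using (_⇔_)
open import Relation.Nullary.Decidable using (⌊_⌋)
open import Relation.Binary.PropositionalEquality using (_≡_)

fib : ℕ → ℕ
fib zero = 0
fib (suc zero) = 1
fib (suc (suc n)) = fib (suc n) ℕ.+ fib n

-- Weights of B_r, stored as TWICE their ε-coordinates (so that ϖ_r and ρ,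
-- which have half-integer coordinates, become integral).  Wt r = Fin r → ℤ.
Wt : ℕ → Set
Wt r = Fin r → ℤ

sumFin : ∀ {n} → (Fin n → ℤ) → ℤ
sumFin {zero} f = + 0
sumFin {suc n} f = f Fin.zero + sumFin (λ i → f (Fin.suc i))

e2 : ∀ {r} → Fin r → Wt r
e2 i j = if ⌊ i Fin.≟ j ⌋ then + 2 else + 0

-- twice the fundamental weight ϖ_{i+1} (i : Fin r indexes ϖ_1 … ϖ_r):
-- ϖ_{i+1} = ε_1 + … + ε_{i+1} for i+1 < r, ϖ_r = ½(ε_1 + … + ε_r)
ϖ : ∀ {r} → Fin r → Wt r
ϖ {r} i j = if ⌊ suc (toℕ i) ℕ.≟ r ⌋ then + 1
            else (if ⌊ toℕ j ℕ.≤? toℕ i ⌋ then + 2 else + 0)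

ρ : ∀ {r} → Wt r
ρ j = sumFin (λ i → ϖ i j)

_⊕_ : ∀ {r} → Wt r → Wt r → Wt r
(x ⊕ y) j = x j + y j

_⊖_ : ∀ {r} → Wt r → Wt r → Wt r
(x ⊖ y) j = x j - y j

_·_ : ∀ {r} → ℕ → Wt r → Wt r
(n · x) j = + n * x j

data PosRoot (r : ℕ) : Set where
  minusRoot : (i j : Fin r) → i Fin.< j → PosRoot r
  plusRoot  : (i j : Fin r) → i Fin.< j → PosRoot r
  shortRoot : (i : Fin r) → PosRoot r

root : ∀ {r} → PosRoot r → Wt r
root (minusRoot i j _) = e2 i ⊖ e2 j
root (plusRoot i j _)  = e2 i ⊕ e2 j
root (shortRoot i)     = e2 i

sumRoots : ∀ {r} → List (PosRoot r) → Wt r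
sumRoots = foldr (λ α v → root α ⊕ v) (λ _ → + 0)

-- ℘(ξ) > 0 : ξ is a nonnegative integral combination of positive roots,
-- i.e. some multiset of positive roots sums to ξ.  (ξ given doubled.)
℘Pos : ∀ {r} → Wt r → Set
℘Pos {r} ξ = ∃ λ (rs : List (PosRoot r)) → ∀ j → sumRoots rs j ≡ ξ j

-- Weyl group of B_r = signed permutations of ε_1,…,ε_r.
-- A candidate element is a pair (π , s); it lies in W iff π is injective.
SignedPerm : ℕ → Set
SignedPerm r = Vec (Fin r) r × Vec Bool r

InW : ∀ {r} → SignedPerm r → Set
InW {r} (π Data.Product., s) = ∀ i j → lookup π i ≡ lookup π j → i ≡ j

applySign : Bool → ℤ → ℤ
applySign true  z = z
applySign false z = - z

act : ∀ {r} → SignedPerm r → Wt r → Wt r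
act (π Data.Product., s) x j = applySign (lookup s j) (x (lookup π j))

𝒜 : ∀ {r} → Wt r → Wt r → SignedPerm r → Set
𝒜 λ' μ σ = InW σ × ℘Pos (act σ (λ' ⊕ ρ) ⊖ (μ ⊕ ρ))

HasCard : ∀ {r} → (SignedPerm r → Set) → ℕ → Set
HasCard {r} P n = ∃ λ (xs : List (SignedPerm r)) →
  Unique xs × (∀ σ → (σ ∈ xs) ⇔ P σ) × length xs ≡ n

{-# OPTIONS --safe #-}
-- In doubled coordinates σ(λ + ρ) − (μ + ρ) = 2η with η integral, and 2η is a sum of positive
-- roots iff every partial sum η₁ + ⋯ + η_i is nonnegative (take η₁ copies of ε₁ − ε₂ and
-- recurse). Here λ + ρ exceeds μ + ρ by 2k + 1 in the first coordinate and falls short by 2k in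
-- the second, so the first partial sum forces σ to fix ε₁, and what remains says that the
-- partial sums of ρ − τρ never exceed 1, for τ the restriction of σ to ε₂, …, ε_r. Reading τ
-- from the left, every coordinate is then fixed, swapped with its right neighbour, or, only if
-- it is the last one, negated. Such patterns are tilings of a strip of length r − 1, and there
-- are F_{r+1} of them.
module Submission where

open import Defs
open import Data.Nat using (ℕ; _+_; _*_; _∸_; _%_; _≤_)
open import Data.Fin using (Fin; zero; suc)
open import Relation.Binary.PropositionalEquality using (_≡_)

open import Data.Nat as ℕ using (zero; suc; _<_; s≤s; z≤n)
import Data.Nat.Properties as ℕ
open import Algebra.Properties.CommutativeSemigroup ℕ.+-commutativeSemigroup using (x∙yz≈yx∙z)
open import Data.Integer as ℤ using (ℤ; +_; -[1+_]; +≤+)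
import Data.Integer.Properties as ℤ
open import Data.Integer.Tactic.RingSolver using (solve-∀)
import Data.Nat.Tactic.RingSolver as NatSolver
open import Data.Fin as Fin using (toℕ; fromℕ<)
import Data.Fin.Properties as Fin
open import Data.Bool using (Bool; true; false; if_then_else_)
open import Data.Vec as Vec using (lookup; tabulate)
import Data.Vec.Properties as Vec
open import Data.List as List using (List; []; _∷_; _++_; replicate; length)
import Data.List.Properties as List
open import Data.List.Membership.Propositional using (_∈_)
open import Data.List.Membership.Propositional.Properties using (∈-map⁺; ∈-map⁻; ∈-++⁺ˡ; ∈-++⁺ʳ)
open import Data.List.Relation.Unary.Any using (here; there)
open import Data.List.Relation.Unary.All using ([]; _∷_)
open import Data.List.Relation.Unary.AllPairs using ([]; _∷_)
open import Data.List.Relation.Unary.Unique.Propositional using (Unique)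
import Data.List.Relation.Unary.Unique.Propositional.Properties as Unique
open import Data.Product using (∃; _×_; _,_; proj₁; proj₂)
open import Data.Sum using (inj₁; inj₂)
open import Data.Empty using (⊥; ⊥-elim)
open import Function using (_∘_)
open import Function.Bundles using (_⇔_; mk⇔; Equivalence)
open import Relation.Binary.PropositionalEquality using (_≢_; refl; sym; trans; cong; cong₂; subst; subst₂; module ≡-Reasoning)
open import Relation.Nullary using (¬_; yes; no)
open import Relation.Nullary.Decidable using (⌊_⌋; isYes≗does; dec-true; dec-false)

private variable
  m r t : ℕ

Σ< : (ℕ → ℤ) → ℕ → ℤ
Σ< g zero    = + 0
Σ< g (suc i) = g 0 ℤ.+ Σ< (g ∘ suc) i

Σ<-snoc : ∀ g i → Σ< g (suc i) ≡ Σ< g i ℤ.+ g i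
Σ<-snoc g zero    = trans (ℤ.+-identityʳ (g 0)) (sym (ℤ.+-identityˡ (g 0)))
Σ<-snoc g (suc i) = trans (cong (ℤ._+_ (g 0)) (Σ<-snoc (g ∘ suc) i)) (sym (ℤ.+-assoc (g 0) _ _))

Σ<-cong : ∀ {g h} i → (∀ {j} → j < i → g j ≡ h j) → Σ< g i ≡ Σ< h i
Σ<-cong zero    eq = refl
Σ<-cong (suc i) eq = cong₂ ℤ._+_ (eq (s≤s z≤n)) (Σ<-cong i (eq ∘ s≤s))

prefix : (Fin m → ℤ) → ℕ → ℤ
prefix         f zero    = + 0
prefix {zero}  f (suc i) = + 0
prefix {suc m} f (suc i) = f zero ℤ.+ prefix (f ∘ suc) i

prefix-toℕ : ∀ g {i} → i ≤ m → prefix {m} (g ∘ toℕ) i ≡ Σ< g i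
prefix-toℕ {zero}  g z≤n     = refl
prefix-toℕ {suc m} g z≤n     = refl
prefix-toℕ {suc m} g (s≤s i≤m) = cong (ℤ._+_ (g 0)) (prefix-toℕ (g ∘ suc) i≤m)

prefix-cong : ∀ {f g : Fin m → ℤ} → (∀ j → f j ≡ g j) → ∀ i → prefix f i ≡ prefix g i
prefix-cong         eq zero    = refl
prefix-cong {zero}  eq (suc i) = refl
prefix-cong {suc m} eq (suc i) = cong₂ ℤ._+_ (eq zero) (prefix-cong (eq ∘ suc) i)

prefix-⊕ : ∀ (f g : Fin m → ℤ) i → prefix (f ⊕ g) i ≡ prefix f i ℤ.+ prefix g i
prefix-⊕         f g zero    = refl
prefix-⊕ {zero}  f g (suc i) = refl
prefix-⊕ {suc m} f g (suc i) = trans (cong (ℤ._+_ (f zero ℤ.+ g zero)) (prefix-⊕ (f ∘ suc) (g ∘ suc) i))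
  (+-interchange (f zero) (g zero) _ _)
  where
  +-interchange : ∀ a b c d → a ℤ.+ b ℤ.+ (c ℤ.+ d) ≡ a ℤ.+ c ℤ.+ (b ℤ.+ d)
  +-interchange = solve-∀

prefix-⊖ : ∀ (f g : Fin m → ℤ) i → prefix (f ⊖ g) i ≡ prefix f i ℤ.- prefix g i
prefix-⊖         f g zero    = refl
prefix-⊖ {zero}  f g (suc i) = refl
prefix-⊖ {suc m} f g (suc i) = trans (cong (ℤ._+_ (f zero ℤ.- g zero)) (prefix-⊖ (f ∘ suc) (g ∘ suc) i))
  (−-interchange (f zero) (g zero) _ _)
  where
  −-interchange : ∀ a b c d → a ℤ.- b ℤ.+ (c ℤ.- d) ≡ a ℤ.+ c ℤ.- (b ℤ.+ d)
  −-interchange = solve-∀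

prefix-double : ∀ (f : Fin m → ℤ) i → prefix (λ j → + 2 ℤ.* f j) i ≡ + 2 ℤ.* prefix f i
prefix-double         f zero    = refl
prefix-double {zero}  f (suc i) = refl
prefix-double {suc m} f (suc i) = trans (cong (ℤ._+_ (+ 2 ℤ.* f zero)) (prefix-double (f ∘ suc) i))
  (sym (ℤ.*-distribˡ-+ (+ 2) (f zero) _))

prefix-zero : ∀ i → prefix {m} (λ _ → + 0) i ≡ + 0
prefix-zero         zero    = refl
prefix-zero {zero}  (suc i) = refl
prefix-zero {suc m} (suc i) = trans (ℤ.+-identityˡ _) (prefix-zero {m} i)

Σ<-zero : ∀ {g} i → (∀ j → g j ≡ + 0) → Σ< g i ≡ + 0
Σ<-zero zero    g≡0 = refl
Σ<-zero (suc i) g≡0 = cong₂ ℤ._+_ (g≡0 0) (Σ<-zero i (g≡0 ∘ suc))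

Σ<-step : ∀ g {i c} → Σ< g i ≡ c → Σ< g (suc i) ≡ c ℤ.+ g i
Σ<-step g {i} Σ≡c = trans (Σ<-snoc g i) (cong (ℤ._+ g i) Σ≡c)

-- Kostant's partition function of type B

e2-suc : ∀ (a j : Fin m) → e2 (suc a) (suc j) ≡ e2 a j
e2-suc a j with a Fin.≟ j
... | yes _ = refl
... | no _  = refl

prefix-e2-≤ : ∀ (a : Fin m) {i} → i ≤ toℕ a → prefix (e2 a) i ≡ + 0
prefix-e2-≤ {suc m} a       {zero}  _         = refl
prefix-e2-≤ {suc m} (suc a) {suc i} (s≤s i≤a) =
  trans (ℤ.+-identityˡ _) (trans (prefix-cong (e2-suc a) i) (prefix-e2-≤ a i≤a))

prefix-e2-> : ∀ (a : Fin m) {i} → toℕ a < i → prefix (e2 a) i ≡ + 2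
prefix-e2-> {suc m} zero    {suc i} _         = cong (ℤ._+_ (+ 2)) (prefix-zero i)
prefix-e2-> {suc m} (suc a) {suc i} (s≤s a<i) =
  trans (ℤ.+-identityˡ _) (trans (prefix-cong (e2-suc a) i) (prefix-e2-> a a<i))

0≤prefix-e2 : ∀ (a : Fin m) i → + 0 ℤ.≤ prefix (e2 a) i
0≤prefix-e2 a i with toℕ a ℕ.<? i
... | yes a<i = subst (+ 0 ℤ.≤_) (sym (prefix-e2-> a a<i)) (+≤+ z≤n)
... | no  a≮i = subst (+ 0 ℤ.≤_) (sym (prefix-e2-≤ a (ℕ.≮⇒≥ a≮i))) (+≤+ z≤n)

0≤prefix-root : ∀ (α : PosRoot m) i → + 0 ℤ.≤ prefix (root α) i
0≤prefix-root (minusRoot a b a<b) i rewrite prefix-⊖ (e2 a) (e2 b) i with toℕ b ℕ.<? i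
... | yes b<i rewrite prefix-e2-> a (ℕ.<-trans a<b b<i) | prefix-e2-> b b<i = +≤+ z≤n
... | no  b≮i rewrite prefix-e2-≤ b (ℕ.≮⇒≥ b≮i) | ℤ.+-identityʳ (prefix (e2 a) i) = 0≤prefix-e2 a i
0≤prefix-root (plusRoot a b _) i rewrite prefix-⊕ (e2 a) (e2 b) i =
  ℤ.+-mono-≤ (0≤prefix-e2 a i) (0≤prefix-e2 b i)
0≤prefix-root (shortRoot a) i = 0≤prefix-e2 a i

0≤prefix-sumRoots : ∀ (rs : List (PosRoot m)) i → + 0 ℤ.≤ prefix (sumRoots rs) i
0≤prefix-sumRoots []       i = subst (+ 0 ℤ.≤_) (sym (prefix-zero i)) (+≤+ z≤n)
0≤prefix-sumRoots (α ∷ rs) i rewrite prefix-⊕ (root α) (sumRoots rs) i =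
  ℤ.+-mono-≤ (0≤prefix-root α i) (0≤prefix-sumRoots rs i)

℘Pos-cong : ∀ {ξ ξ′ : Wt m} → (∀ j → ξ j ≡ ξ′ j) → ℘Pos ξ → ℘Pos ξ′
℘Pos-cong eq (rs , sum≡) = rs , λ j → trans (sum≡ j) (eq j)

℘Pos-double⇒0≤prefix : ∀ (η : Fin m → ℤ) → ℘Pos (λ j → + 2 ℤ.* η j) → ∀ i → + 0 ℤ.≤ prefix η i
℘Pos-double⇒0≤prefix η (rs , sum≡) i = ℤ.*-cancelˡ-≤-pos (+ 0) (prefix η i) (+ 2)
  (subst (+ 0 ℤ.≤_) (trans (prefix-cong sum≡ i) (prefix-double η i)) (0≤prefix-sumRoots rs i))

liftRoot : PosRoot m → PosRoot (suc m)
liftRoot (minusRoot a b a<b) = minusRoot (suc a) (suc b) (s≤s a<b)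
liftRoot (plusRoot a b a<b)  = plusRoot (suc a) (suc b) (s≤s a<b)
liftRoot (shortRoot a)       = shortRoot (suc a)

root-liftRoot-zero : ∀ (α : PosRoot m) → root (liftRoot α) zero ≡ + 0
root-liftRoot-zero (minusRoot _ _ _) = refl
root-liftRoot-zero (plusRoot _ _ _)  = refl
root-liftRoot-zero (shortRoot _)     = refl

root-liftRoot-suc : ∀ (α : PosRoot m) j → root (liftRoot α) (suc j) ≡ root α j
root-liftRoot-suc (minusRoot a b _) j = cong₂ ℤ._-_ (e2-suc a j) (e2-suc b j)
root-liftRoot-suc (plusRoot a b _)  j = cong₂ ℤ._+_ (e2-suc a j) (e2-suc b j)
root-liftRoot-suc (shortRoot a)     j = e2-suc a j

sumRoots-++ : ∀ (xs ys : List (PosRoot m)) j → sumRoots (xs ++ ys) j ≡ sumRoots xs j ℤ.+ sumRoots ys j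
sumRoots-++ []       ys j = sym (ℤ.+-identityˡ _)
sumRoots-++ (α ∷ xs) ys j = trans (cong (ℤ._+_ (root α j)) (sumRoots-++ xs ys j)) (sym (ℤ.+-assoc (root α j) _ _))

sumRoots-replicate : ∀ c (α : PosRoot m) j → sumRoots (replicate c α) j ≡ + c ℤ.* root α j
sumRoots-replicate zero    α j = sym (ℤ.*-zeroˡ (root α j))
sumRoots-replicate (suc c) α j = trans (cong (ℤ._+_ (root α j)) (sumRoots-replicate c α j)) (sym (ℤ.suc-* (+ c) (root α j)))

sumRoots-lift-zero : ∀ (rs : List (PosRoot m)) → sumRoots (List.map liftRoot rs) zero ≡ + 0
sumRoots-lift-zero []       = refl
sumRoots-lift-zero (α ∷ rs) = cong₂ ℤ._+_ (root-liftRoot-zero α) (sumRoots-lift-zero rs)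

sumRoots-lift-suc : ∀ (rs : List (PosRoot m)) j → sumRoots (List.map liftRoot rs) (suc j) ≡ sumRoots rs j
sumRoots-lift-suc []       j = refl
sumRoots-lift-suc (α ∷ rs) j = cong₂ ℤ._+_ (root-liftRoot-suc α j) (sumRoots-lift-suc rs j)

α₁ : PosRoot (suc (suc m))
α₁ = minusRoot zero (suc zero) (s≤s z≤n)

+∣head∣≡head : ∀ {η : Fin (suc m) → ℤ} → (∀ i → i ≤ suc m → + 0 ℤ.≤ prefix η i) → + ℤ.∣ η zero ∣ ≡ η zero
+∣head∣≡head {η = η} 0≤η = ℤ.0≤i⇒+∣i∣≡i (subst (+ 0 ℤ.≤_) (ℤ.+-identityʳ (η zero)) (0≤η 1 (s≤s z≤n)))

mergeHead : (Fin (suc (suc m)) → ℤ) → Fin (suc m) → ℤ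
mergeHead η zero    = η (suc zero) ℤ.+ η zero
mergeHead η (suc j) = η (suc (suc j))

0≤prefix-mergeHead : ∀ {η : Fin (suc (suc m)) → ℤ} → (∀ i → i ≤ suc (suc m) → + 0 ℤ.≤ prefix η i)
                   → ∀ i → i ≤ suc m → + 0 ℤ.≤ prefix (mergeHead η) i
0≤prefix-mergeHead         0≤η zero    _         = +≤+ z≤n
0≤prefix-mergeHead {η = η} 0≤η (suc i) (s≤s i≤m) =
  subst (+ 0 ℤ.≤_) (reassoc (η zero) (η (suc zero)) _) (0≤η (suc (suc i)) (s≤s (s≤s i≤m)))
  where
  reassoc : ∀ x y z → x ℤ.+ (y ℤ.+ z) ≡ y ℤ.+ x ℤ.+ z
  reassoc = solve-∀

-- η₀ copies of ε₀ − ε₁ give back to the first coordinate what mergeHead moved to the second.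
sumRoots-unmerge : ∀ {η : Fin (suc (suc m)) → ℤ} (rs : List (PosRoot (suc m))) → + ℤ.∣ η zero ∣ ≡ η zero
  → (∀ j → sumRoots rs j ≡ + 2 ℤ.* mergeHead η j)
  → ∀ j → sumRoots (replicate ℤ.∣ η zero ∣ α₁ ++ List.map liftRoot rs) j ≡ + 2 ℤ.* η j
sumRoots-unmerge {η = η} rs c≡ rs≡ j =
  trans (sumRoots-++ (replicate c α₁) _ j)
        (trans (cong (ℤ._+ sumRoots (List.map liftRoot rs) j) (sumRoots-replicate c α₁ j)) (split j))
  where
  c = ℤ.∣ η zero ∣
  split : ∀ j → + c ℤ.* root α₁ j ℤ.+ sumRoots (List.map liftRoot rs) j ≡ + 2 ℤ.* η j
  split zero = trans (cong₂ (λ x y → x ℤ.* + 2 ℤ.+ y) c≡ (sumRoots-lift-zero rs)) (double (η zero))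
    where
    double : ∀ x → x ℤ.* + 2 ℤ.+ + 0 ≡ + 2 ℤ.* x
    double = solve-∀
  split (suc zero) =
    trans (cong₂ (λ x y → x ℤ.* ℤ.- + 2 ℤ.+ y) c≡ (trans (sumRoots-lift-suc rs zero) (rs≡ zero)))
          (transfer (η zero) (η (suc zero)))
    where
    transfer : ∀ x y → x ℤ.* ℤ.- + 2 ℤ.+ + 2 ℤ.* (y ℤ.+ x) ≡ + 2 ℤ.* y
    transfer = solve-∀
  split (suc (suc j)) =
    trans (cong₂ ℤ._+_ (ℤ.*-zeroʳ (+ c)) (trans (sumRoots-lift-suc rs (suc j)) (rs≡ (suc j)))) (ℤ.+-identityˡ _)

0≤prefix⇒℘Pos-double : ∀ (η : Fin m → ℤ) → (∀ i → i ≤ m → + 0 ℤ.≤ prefix η i) → ℘Pos (λ j → + 2 ℤ.* η j)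
0≤prefix⇒℘Pos-double {zero} η 0≤η = [] , λ ()
0≤prefix⇒℘Pos-double {suc zero} η 0≤η = replicate ℤ.∣ η zero ∣ (shortRoot zero) , λ
  { zero → trans (sumRoots-replicate ℤ.∣ η zero ∣ (shortRoot zero) zero)
                 (trans (ℤ.*-comm (+ ℤ.∣ η zero ∣) (+ 2)) (cong (ℤ._*_ (+ 2)) (+∣head∣≡head 0≤η))) }
0≤prefix⇒℘Pos-double {suc (suc m)} η 0≤η
  with 0≤prefix⇒℘Pos-double (mergeHead η) (0≤prefix-mergeHead 0≤η)
... | rs , rs≡ = replicate ℤ.∣ η zero ∣ α₁ ++ List.map liftRoot rs
                 , sumRoots-unmerge rs (+∣head∣≡head 0≤η) rs≡

ρ-coord : ℕ → ℕ → ℤ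
ρ-coord r m = + 2 ℤ.* (+ r ℤ.- + m) ℤ.- + 1

sumFin-toℕ : ∀ g → sumFin {m} (g ∘ toℕ) ≡ Σ< g m
sumFin-toℕ {zero}  g = refl
sumFin-toℕ {suc m} g = cong (ℤ._+_ (g 0)) (sumFin-toℕ {m} (g ∘ suc))

twice[_≤_] : ℕ → ℕ → ℤ
twice[ J ≤ t ] = if ⌊ J ℕ.≤? t ⌋ then + 2 else + 0

-- ϖ i j is definitionally ϖ-entry r (toℕ j) (toℕ i).
ϖ-entry : ℕ → ℕ → ℕ → ℤ
ϖ-entry r J t = if ⌊ suc t ℕ.≟ r ⌋ then + 1 else twice[ J ≤ t ]

twice[≤]-suc : ∀ J t → twice[ suc J ≤ suc t ] ≡ twice[ J ≤ t ]
twice[≤]-suc zero    t = refl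
twice[≤]-suc (suc J) t = cong (if_then + 2 else + 0)
  (trans (isYes≗does (suc (suc J) ℕ.≤? suc t)) (sym (isYes≗does (suc J ℕ.≤? t))))

Σ<-twice[≤] : ∀ J t → J ≤ t → Σ< twice[ J ≤_] t ≡ + (2 * (t ∸ J))
Σ<-twice[≤] zero    zero    _         = refl
Σ<-twice[≤] zero    (suc t) _         =
  trans (cong (ℤ._+_ (+ 2)) (Σ<-twice[≤] zero t z≤n)) (cong +_ (sym (ℕ.*-suc 2 t)))
Σ<-twice[≤] (suc J) (suc t) (s≤s J≤t) =
  trans (ℤ.+-identityˡ _) (trans (Σ<-cong t (λ {j} _ → twice[≤]-suc J j)) (Σ<-twice[≤] J t J≤t))

ϖ-entry-last : ∀ d J → ϖ-entry (suc d) J d ≡ + 1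
ϖ-entry-last d J = cong (if_then + 1 else twice[ J ≤ d ])
  (trans (isYes≗does (suc d ℕ.≟ suc d)) (dec-true (suc d ℕ.≟ suc d) refl))

ϖ-entry-below : ∀ {d J t} → t < d → ϖ-entry (suc d) J t ≡ twice[ J ≤ t ]
ϖ-entry-below {d} {J} {t} t<d = cong (if_then + 1 else twice[ J ≤ t ])
  (trans (isYes≗does (suc t ℕ.≟ suc d)) (dec-false (suc t ℕ.≟ suc d) (ℕ.<⇒≢ (s≤s t<d))))

ρ-coordinate : ∀ (j : Fin r) → ρ j ≡ ρ-coord r (toℕ j)
ρ-coordinate {suc d} j = begin
  ρ j                                                  ≡⟨ sumFin-toℕ {suc d} (ϖ-entry (suc d) J) ⟩
  Σ< (ϖ-entry (suc d) J) (suc d)                       ≡⟨ Σ<-snoc (ϖ-entry (suc d) J) d ⟩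
  Σ< (ϖ-entry (suc d) J) d ℤ.+ ϖ-entry (suc d) J d     ≡⟨ cong₂ ℤ._+_ (Σ<-cong d ϖ-entry-below) (ϖ-entry-last d J) ⟩
  Σ< twice[ J ≤_] d ℤ.+ + 1                            ≡⟨ cong (ℤ._+ + 1) (Σ<-twice[≤] J d J≤d) ⟩
  + (2 * (d ∸ J)) ℤ.+ + 1                              ≡⟨ cong (λ x → x ℤ.+ + 1) (trans (ℤ.pos-* 2 (d ∸ J)) (cong (ℤ._*_ (+ 2)) d∸J≡)) ⟩
  + 2 ℤ.* (+ d ℤ.- + J) ℤ.+ + 1                        ≡⟨ shift (+ d) (+ J) ⟩
  ρ-coord (suc d) J                                    ∎
  where
  open ≡-Reasoning
  J = toℕ j
  J≤d : J ≤ d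
  J≤d = ℕ.≤-pred (Fin.toℕ<n j)
  d∸J≡ : + (d ∸ J) ≡ + d ℤ.- + J
  d∸J≡ = sym (trans (ℤ.m-n≡m⊖n d J) (ℤ.⊖-≥ J≤d))
  shift : ∀ x y → + 2 ℤ.* (x ℤ.- y) ℤ.+ + 1 ≡ + 2 ℤ.* (+ 1 ℤ.+ x ℤ.- y) ℤ.- + 1
  shift = solve-∀

-- b·ρ_m − ρ_j for ρ of B_D, whose coordinates are ρ_m = D − m − ½ (counting from 0).
excess : ℕ → Bool → ℕ → ℕ → ℤ
excess D true  m j = + j ℤ.- + m
excess D false m j = + m ℤ.+ + j ℤ.+ + 1 ℤ.- (+ D ℤ.+ + D)

excesses : ℕ → (ℕ → ℕ) → (ℕ → Bool) → ℕ → ℤ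
excesses D p s j = excess D (s j) (p j) j

Admissible : ℕ → (ℕ → ℕ) → (ℕ → Bool) → Set
Admissible D p s = ∀ i → i ≤ D → + 0 ℤ.≤ + 1 ℤ.+ Σ< (excesses D p s) i

excess-suc : ∀ D b m j → excess (suc D) b (suc m) (suc j) ≡ excess D b m j
excess-suc D true  m j = cancel (+ j) (+ m)
  where
  cancel : ∀ x y → + 1 ℤ.+ x ℤ.- (+ 1 ℤ.+ y) ≡ x ℤ.- y
  cancel = solve-∀
excess-suc D false m j = cancel (+ m) (+ j) (+ D)
  where
  cancel : ∀ x y z → + 1 ℤ.+ x ℤ.+ (+ 1 ℤ.+ y) ℤ.+ + 1 ℤ.- (+ 1 ℤ.+ z ℤ.+ (+ 1 ℤ.+ z)) ≡ x ℤ.+ y ℤ.+ + 1 ℤ.- (z ℤ.+ z)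
  cancel = solve-∀

excess-diag : ∀ D j → excess D true j j ≡ + 0
excess-diag D j = ℤ.+-inverseʳ (+ j)

excess-shift : ∀ k D b m j → excess (k + D) b (k + m) (k + j) ≡ excess D b m j
excess-shift zero    D b m j = refl
excess-shift (suc k) D b m j = trans (excess-suc (k + D) b (k + m) (k + j)) (excess-shift k D b m j)

Σ<-excesses-shift : ∀ k D (p : ℕ → ℕ) s i →
  Σ< (λ j → excess (k + D) (s j) (k + p j) (k + j)) i ≡ Σ< (excesses D p s) i
Σ<-excesses-shift k D p s i = Σ<-cong i (λ {j} _ → excess-shift k D (s j) (p j) j)

applySign-ρ-coord : ∀ b x y D m j →
  applySign b (+ 2 ℤ.* x ℤ.+ ρ-coord D m) ℤ.- (+ 2 ℤ.* y ℤ.+ ρ-coord D j)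
    ≡ + 2 ℤ.* (applySign b x ℤ.- y ℤ.+ excess D b m j)
applySign-ρ-coord true  x y D m j = halve x y (+ D) (+ m) (+ j)
  where
  halve : ∀ x y D m j → + 2 ℤ.* x ℤ.+ (+ 2 ℤ.* (D ℤ.- m) ℤ.- + 1) ℤ.- (+ 2 ℤ.* y ℤ.+ (+ 2 ℤ.* (D ℤ.- j) ℤ.- + 1))
                        ≡ + 2 ℤ.* (x ℤ.- y ℤ.+ (j ℤ.- m))
  halve = solve-∀
applySign-ρ-coord false x y D m j = halve x y (+ D) (+ m) (+ j)
  where
  halve : ∀ x y D m j → ℤ.- (+ 2 ℤ.* x ℤ.+ (+ 2 ℤ.* (D ℤ.- m) ℤ.- + 1)) ℤ.- (+ 2 ℤ.* y ℤ.+ (+ 2 ℤ.* (D ℤ.- j) ℤ.- + 1))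
                        ≡ + 2 ℤ.* (ℤ.- x ℤ.- y ℤ.+ (m ℤ.+ j ℤ.+ + 1 ℤ.- (D ℤ.+ D)))
  halve = solve-∀

applySign-0 : ∀ b → applySign b (+ 0) ≡ + 0
applySign-0 true  = refl
applySign-0 false = refl

-- Tilings

-- t cells covered by fixed cells and swapped adjacent pairs, where the last cell may be negated
-- instead; perm and sign describe the signed permutation this encodes.
data Tiling : ℕ → Set where
  done : Tiling 0
  neg  : Tiling 1
  fix  : Tiling t → Tiling (suc t)
  swap : Tiling t → Tiling (suc (suc t))

perm : Tiling t → ℕ → ℕ
perm done           j             = j
perm neg            j             = j
perm (fix T)        zero          = zero
perm (fix T)        (suc j)       = suc (perm T j)
perm (swap T)       zero          = 1
perm (swap T)       (suc zero)    = 0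
perm (swap T)       (suc (suc j)) = suc (suc (perm T j))

sign : Tiling t → ℕ → Bool
sign done     j             = true
sign neg      zero          = false
sign neg      (suc j)       = true
sign (fix T)  zero          = true
sign (fix T)  (suc j)       = sign T j
sign (swap T) zero          = true
sign (swap T) (suc zero)    = true
sign (swap T) (suc (suc j)) = sign T j

perm-involutive : ∀ (T : Tiling t) j → perm T (perm T j) ≡ j
perm-involutive done     j             = refl
perm-involutive neg      j             = refl
perm-involutive (fix T)  zero          = refl
perm-involutive (fix T)  (suc j)       = cong suc (perm-involutive T j)
perm-involutive (swap T) zero          = refl
perm-involutive (swap T) (suc zero)    = refl
perm-involutive (swap T) (suc (suc j)) = cong (λ k → suc (suc k)) (perm-involutive T j)

perm-< : ∀ (T : Tiling t) {j} → j < t → perm T j < t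
perm-< done     j<0                       = j<0
perm-< neg      j<1                       = j<1
perm-< (fix T)  {zero}        _           = s≤s z≤n
perm-< (fix T)  {suc j}       (s≤s j<t)   = s≤s (perm-< T j<t)
perm-< (swap T) {zero}        _           = s≤s (s≤s z≤n)
perm-< (swap T) {suc zero}    _           = s≤s z≤n
perm-< (swap T) {suc (suc j)} (s≤s (s≤s j<t)) = s≤s (s≤s (perm-< T j<t))

Agree : Tiling t → Tiling t → Set
Agree {t} T T′ = ∀ {j} → j < t → perm T j ≡ perm T′ j × sign T j ≡ sign T′ j

agree⇒≡ : ∀ (T T′ : Tiling t) → Agree T T′ → T ≡ T′
agree⇒≡ done     done      _  = refl
agree⇒≡ neg      neg       _  = refl
agree⇒≡ neg      (fix done) eq with proj₂ (eq (s≤s z≤n))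
... | ()
agree⇒≡ (fix done) neg     eq with proj₂ (eq (s≤s z≤n))
... | ()
agree⇒≡ (fix T)  (fix T′)  eq = cong fix (agree⇒≡ T T′ λ j<t →
  let p≡ , s≡ = eq (s≤s j<t) in ℕ.suc-injective p≡ , s≡)
agree⇒≡ (fix T)  (swap T′) eq with proj₁ (eq (s≤s z≤n))
... | ()
agree⇒≡ (swap T) (fix T′)  eq with proj₁ (eq (s≤s z≤n))
... | ()
agree⇒≡ (swap T) (swap T′) eq = cong swap (agree⇒≡ T T′ λ j<t →
  let p≡ , s≡ = eq (s≤s (s≤s j<t)) in ℕ.suc-injective (ℕ.suc-injective p≡) , s≡)

tilings : ∀ t → List (Tiling t)
tilings zero          = done ∷ []
tilings (suc zero)    = fix done ∷ neg ∷ []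
tilings (suc (suc t)) = List.map fix (tilings (suc t)) ++ List.map swap (tilings t)

∈-tilings : ∀ (T : Tiling t) → T ∈ tilings t
∈-tilings done                = here refl
∈-tilings neg                 = there (here refl)
∈-tilings (fix done)          = here refl
∈-tilings (fix {suc t} T)     = ∈-++⁺ˡ (∈-map⁺ fix (∈-tilings T))
∈-tilings (swap {t} T)        = ∈-++⁺ʳ (List.map fix (tilings (suc t))) (∈-map⁺ swap (∈-tilings T))

fix-injective : ∀ {T T′ : Tiling t} → fix T ≡ fix T′ → T ≡ T′
fix-injective refl = refl

swap-injective : ∀ {T T′ : Tiling t} → swap T ≡ swap T′ → T ≡ T′
swap-injective refl = refl

tilings-unique : ∀ t → Unique (tilings t)
tilings-unique zero          = [] ∷ []
tilings-unique (suc zero)    = ((λ ()) ∷ []) ∷ [] ∷ []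
tilings-unique (suc (suc t)) = Unique.++⁺ (Unique.map⁺ fix-injective (tilings-unique (suc t)))
  (Unique.map⁺ swap-injective (tilings-unique t)) fix≢swap
  where
  fix≢swap : ∀ {T} → ¬ (T ∈ List.map fix (tilings (suc t)) × T ∈ List.map swap (tilings t))
  fix≢swap (∈fix , ∈swap) with ∈-map⁻ fix ∈fix | ∈-map⁻ swap ∈swap
  ... | _ , _ , refl | _ , _ , ()

length-tilings : ∀ t → length (tilings t) ≡ fib (suc (suc t))
length-tilings zero          = refl
length-tilings (suc zero)    = refl
length-tilings (suc (suc t)) = begin
  length (List.map fix (tilings (suc t)) ++ List.map swap (tilings t))
    ≡⟨ List.length-++ (List.map fix (tilings (suc t))) ⟩
  length (List.map fix (tilings (suc t))) + length (List.map swap (tilings t))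
    ≡⟨ cong₂ _+_ (List.length-map fix (tilings (suc t))) (List.length-map swap (tilings t)) ⟩
  length (tilings (suc t)) + length (tilings t)
    ≡⟨ cong₂ _+_ (length-tilings (suc t)) (length-tilings t) ⟩
  fib (suc (suc (suc t))) + fib (suc (suc t)) ∎
  where open ≡-Reasoning

tiling-admissible : ∀ (T : Tiling t) → Admissible t (perm T) (sign T)
tiling-admissible T i _ = 0≤1+Σ< T i
  where
  0≤1+ : ∀ {x y} → x ≡ y → + 0 ℤ.≤ + 1 ℤ.+ y → + 0 ℤ.≤ + 1 ℤ.+ x
  0≤1+ x≡y = subst (λ z → + 0 ℤ.≤ + 1 ℤ.+ z) (sym x≡y)
  0≤1+Σ< : ∀ {t} (T : Tiling t) i → + 0 ℤ.≤ + 1 ℤ.+ Σ< (excesses t (perm T) (sign T)) i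
  0≤1+Σ< done     i             = 0≤1+ (Σ<-zero i (excess-diag 0)) (+≤+ z≤n)
  0≤1+Σ< neg      zero          = +≤+ z≤n
  0≤1+Σ< neg      (suc i)       = 0≤1+ (cong (ℤ._+_ -[1+ 0 ]) (Σ<-zero i (excess-diag 1 ∘ suc))) (+≤+ z≤n)
  0≤1+Σ< (fix T)  zero          = +≤+ z≤n
  0≤1+Σ< (fix T)  (suc i)       =
    0≤1+ (trans (ℤ.+-identityˡ _) (Σ<-excesses-shift 1 _ (perm T) (sign T) i)) (0≤1+Σ< T i)
  0≤1+Σ< (swap T) zero          = +≤+ z≤n
  0≤1+Σ< (swap T) (suc zero)    = +≤+ z≤n
  0≤1+Σ< (swap {t} T) (suc (suc i)) =
    0≤1+ (trans (cong (λ x → -[1+ 0 ] ℤ.+ (+ 1 ℤ.+ x)) (Σ<-excesses-shift 2 t (perm T) (sign T) i)) (cancel (Σ< (excesses t (perm T) (sign T)) i)))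
         (0≤1+Σ< T i)
    where
    cancel : ∀ x → -[1+ 0 ] ℤ.+ (+ 1 ℤ.+ x) ≡ x
    cancel = solve-∀

-- Reading a tiling off an admissible signed permutation

0≤x-y⇒y≤x : ∀ {x y} → + 0 ℤ.≤ + x ℤ.- + y → y ≤ x
0≤x-y⇒y≤x h = ℤ.drop‿+≤+ (ℤ.0≤i-j⇒j≤i h)

0≤1+excess-true : ∀ {D m j} → + 0 ℤ.≤ + 1 ℤ.+ excess D true m j → m ≤ suc j
0≤1+excess-true {D} {m} {j} h = 0≤x-y⇒y≤x (subst (+ 0 ℤ.≤_) (reassoc (+ 1) (+ j) (+ m)) h)
  where
  reassoc : ∀ x y z → x ℤ.+ (y ℤ.- z) ≡ x ℤ.+ y ℤ.- z
  reassoc = solve-∀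

0≤excess-false : ∀ {D m j} → + 0 ℤ.≤ excess D false m j → D + D ≤ suc m + j
0≤excess-false {D} {m} {j} h = 0≤x-y⇒y≤x (subst (+ 0 ℤ.≤_) (reassoc (+ m) (+ j) (+ D)) h)
  where
  reassoc : ∀ x y z → x ℤ.+ y ℤ.+ + 1 ℤ.- (z ℤ.+ z) ≡ + 1 ℤ.+ x ℤ.+ y ℤ.- (z ℤ.+ z)
  reassoc = solve-∀

0≤1+excess-false : ∀ {D m j} → + 0 ℤ.≤ + 1 ℤ.+ excess D false m j → D + D ≤ suc m + suc j
0≤1+excess-false {D} {m} {j} h = 0≤x-y⇒y≤x (subst (+ 0 ℤ.≤_) (reassoc (+ m) (+ j) (+ D)) h)
  where
  reassoc : ∀ x y z → + 1 ℤ.+ (x ℤ.+ y ℤ.+ + 1 ℤ.- (z ℤ.+ z)) ≡ + 1 ℤ.+ x ℤ.+ (+ 1 ℤ.+ y) ℤ.- (z ℤ.+ z)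
  reassoc = solve-∀

sum-at-top : ∀ {D m j} → m < D → j < D → D + D ≤ suc m + suc j → suc m ≡ D
sum-at-top m<D j<D top = ℕ.≤-antisym m<D (ℕ.≮⇒≥ λ sm<D → ℕ.<⇒≱ (ℕ.+-mono-<-≤ sm<D j<D) top)

sum-over-top : ∀ {D m j} → m < D → j < D → D + D ≤ suc m + j → ⊥
sum-over-top {D} {m} {j} m<D j<D over = ℕ.<⇒≱ (ℕ.+-mono-≤-< m<D j<D) over

module Greedy {D : ℕ} {p : ℕ → ℕ} {s : ℕ → Bool}
  (p-< : ∀ {j} → j < D → p j < D)
  (p-injective : ∀ {j j′} → j < D → j′ < D → p j ≡ p j′ → j ≡ j′)
  (admissible : Admissible D p s)
  where

  Closed : ℕ → Set
  Closed x = ∀ {y} → x ≤ y → y < D → x ≤ p y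

  Balanced : ℕ → Set
  Balanced x = Σ< (excesses D p s) x ≡ + 0

  TiledFrom : ℕ → Tiling t → Set
  TiledFrom {t} x T = ∀ {j} → j < t → p (x + j) ≡ x + perm T j × s (x + j) ≡ sign T j

  data Move (x : ℕ) : Set where
    negMove  : s x ≡ false → p x ≡ x → suc x ≡ D → Move x
    fixMove  : s x ≡ true → p x ≡ x → Move x
    swapMove : s x ≡ true → p x ≡ suc x → s (suc x) ≡ true → p (suc x) ≡ x → Move x

  p≢ : ∀ {y z} → y < D → z < D → y ≢ z → p y ≢ p z
  p≢ y<D z<D y≢z = y≢z ∘ p-injective y<D z<D

  0≤1+excess : ∀ {x} → x < D → Balanced x → + 0 ℤ.≤ + 1 ℤ.+ excesses D p s x
  0≤1+excess {x} x<D bal =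
    subst (λ e → + 0 ℤ.≤ + 1 ℤ.+ e) (trans (Σ<-step (excesses D p s) {x} bal) (ℤ.+-identityˡ (excesses D p s x))) (admissible (suc x) x<D)

  Σ<-swap-start : ∀ {x} → Balanced x → s x ≡ true → p x ≡ suc x → Σ< (excesses D p s) (suc x) ≡ -[1+ 0 ]
  Σ<-swap-start {x} bal sx px = trans (Σ<-step (excesses D p s) {x} bal)
    (trans (cong₂ (λ b m → + 0 ℤ.+ excess D b m x) sx px) (one-down (+ x)))
    where
    one-down : ∀ x → + 0 ℤ.+ (x ℤ.- (+ 1 ℤ.+ x)) ≡ -[1+ 0 ]
    one-down = solve-∀

  swap-partner : ∀ {x} → suc x < D → Closed x → Balanced x → s x ≡ true → p x ≡ suc x
               → s (suc x) ≡ true × p (suc x) ≡ x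
  swap-partner {x} y<D closed bal sx px = classify (s (suc x)) refl 0≤excess
    where
    x<D = ℕ.<-trans (ℕ.n<1+n x) y<D
    0≤excess : + 0 ℤ.≤ excesses D p s (suc x)
    0≤excess = subst (+ 0 ℤ.≤_) (trans (cong (ℤ._+_ (+ 1)) (Σ<-step (excesses D p s) {suc x} (Σ<-swap-start bal sx px))) (cancel _))
                     (admissible (suc (suc x)) y<D)
      where
      cancel : ∀ e → + 1 ℤ.+ (-[1+ 0 ] ℤ.+ e) ≡ e
      cancel = solve-∀
    py≢y : p (suc x) ≢ suc x
    py≢y py≡ = p≢ y<D x<D (ℕ.<⇒≢ (ℕ.n<1+n x) ∘ sym) (trans py≡ (sym px))
    classify : ∀ b → s (suc x) ≡ b → + 0 ℤ.≤ excess D b (p (suc x)) (suc x) → s (suc x) ≡ true × p (suc x) ≡ x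
    classify false _  h = ⊥-elim (sum-over-top (p-< y<D) y<D (0≤excess-false {D} {p (suc x)} h))
    classify true  sy h = sy , ℕ.≤-antisym (ℕ.≤-pred (ℕ.≤∧≢⇒< (0≤x-y⇒y≤x h) py≢y))
                                           (closed (ℕ.n≤1+n x) y<D)

  move : ∀ {x} → x < D → Closed x → Balanced x → Move x
  move {x} x<D closed bal = classify (s x) refl (0≤1+excess x<D bal)
    where
    x≤px = closed ℕ.≤-refl x<D
    classify : ∀ b → s x ≡ b → + 0 ℤ.≤ + 1 ℤ.+ excess D b (p x) x → Move x
    classify false sx h = negMove sx (ℕ.suc-injective (trans px-top (sym x-top))) x-top
      where
      top = 0≤1+excess-false {D} h
      px-top = sum-at-top (p-< x<D) x<D top
      x-top = sum-at-top x<D (p-< x<D) (subst (D + D ≤_) (ℕ.+-comm (suc (p x)) (suc x)) top)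
    classify true sx h with ℕ.m≤n⇒m<n∨m≡n x≤px
    ... | inj₂ x≡px = fixMove sx (sym x≡px)
    ... | inj₁ x<px = swapMove sx px sy py
      where
      px = ℕ.≤-antisym (0≤1+excess-true {D} h) x<px
      partner = swap-partner (subst (_< D) px (p-< x<D)) closed bal sx px
      sy = proj₁ partner
      py = proj₂ partner

  balanced-fix : ∀ {x} → Balanced x → s x ≡ true → p x ≡ x → Balanced (suc x)
  balanced-fix {x} bal sx px = trans (Σ<-step (excesses D p s) {x} bal)
    (trans (cong₂ (λ b m → + 0 ℤ.+ excess D b m x) sx px) (cong (ℤ._+_ (+ 0)) (excess-diag D x)))

  balanced-swap : ∀ {x} → Balanced x → s x ≡ true → p x ≡ suc x → s (suc x) ≡ true → p (suc x) ≡ x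
                → Balanced (suc (suc x))
  balanced-swap {x} bal sx px sy py = trans (Σ<-step (excesses D p s) {suc x} (Σ<-swap-start bal sx px))
    (trans (cong₂ (λ b m → -[1+ 0 ] ℤ.+ excess D b m (suc x)) sy py) (one-up (+ x)))
    where
    one-up : ∀ x → -[1+ 0 ] ℤ.+ (+ 1 ℤ.+ x ℤ.- x) ≡ + 0
    one-up = solve-∀

  closed-fix : ∀ {x} → Closed x → p x ≡ x → Closed (suc x)
  closed-fix {x} closed px {y} x<y y<D = ℕ.≤∧≢⇒< (closed (ℕ.<⇒≤ x<y) y<D)
    λ x≡py → p≢ y<D (ℕ.<-trans x<y y<D) (ℕ.<⇒≢ x<y ∘ sym) (trans (sym x≡py) (sym px))

  closed-swap : ∀ {x} → Closed x → p x ≡ suc x → p (suc x) ≡ x → Closed (suc (suc x))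
  closed-swap {x} closed px py {y} y>x+1 y<D = ℕ.≤∧≢⇒< x<py
    λ x+1≡py → p≢ y<D x<D (ℕ.<⇒≢ (ℕ.<-trans (ℕ.n<1+n x) y>x+1) ∘ sym) (trans (sym x+1≡py) (sym px))
    where
    x+1<D = ℕ.<-trans y>x+1 y<D
    x<D = ℕ.<-trans (ℕ.n<1+n x) x+1<D
    x<py : x < p y
    x<py = ℕ.≤∧≢⇒< (closed (ℕ.<⇒≤ (ℕ.<-trans (ℕ.n<1+n x) y>x+1)) y<D)
      λ x≡py → p≢ y<D x+1<D (ℕ.<⇒≢ y>x+1 ∘ sym) (trans (sym x≡py) (sym py))

  tiled-shift : ∀ k {x} {T : Tiling t} → TiledFrom (k + x) T
              → ∀ {j} → j < t → p (x + (k + j)) ≡ x + (k + perm T j) × s (x + (k + j)) ≡ sign T j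
  tiled-shift k {x} {T} tiled {j} j<t rewrite x∙yz≈yx∙z x k j | x∙yz≈yx∙z x k (perm T j) = tiled j<t

  tiled-neg : ∀ {x} → s x ≡ false → p x ≡ x → TiledFrom x neg
  tiled-neg {x} sx px {zero} _ rewrite ℕ.+-identityʳ x = px , sx
  tiled-neg     sx px {suc _} (s≤s ())

  tiled-fix : ∀ {x} {T : Tiling t} → s x ≡ true → p x ≡ x → TiledFrom (suc x) T → TiledFrom x (fix T)
  tiled-fix {x = x} sx px tiled {zero}  _         rewrite ℕ.+-identityʳ x = px , sx
  tiled-fix         sx px tiled {suc j} (s≤s j<t) = tiled-shift 1 tiled j<t

  tiled-swap : ∀ {x} {T : Tiling t} → s x ≡ true → p x ≡ suc x → s (suc x) ≡ true → p (suc x) ≡ x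
             → TiledFrom (suc (suc x)) T → TiledFrom x (swap T)
  tiled-swap {x = x} sx px sy py tiled {zero}        _ rewrite ℕ.+-identityʳ x | ℕ.+-comm x 1 = px , sx
  tiled-swap {x = x} sx px sy py tiled {suc zero}    _ rewrite ℕ.+-comm x 1 | ℕ.+-identityʳ x = py , sy
  tiled-swap         sx px sy py tiled {suc (suc j)} (s≤s (s≤s j<t)) = tiled-shift 2 tiled j<t

  <-of-+suc : ∀ {x t} → x + suc t ≡ D → x < D
  <-of-+suc {x} x+t≡D = subst (x <_) x+t≡D (ℕ.m<m+n x (s≤s z≤n))

  greedy : ∀ x t → x + t ≡ D → Closed x → Balanced x → ∃ λ (T : Tiling t) → TiledFrom x T
  greedy x zero    _     _      _   = done , λ ()
  greedy x (suc t) x+t≡D closed bal with move (<-of-+suc x+t≡D) closed bal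
  ... | negMove sx px x+1≡D with t
  ...   | zero   = neg , tiled-neg sx px
  ...   | suc t′ = ⊥-elim (ℕ.m+1+n≢m x (ℕ.suc-injective (trans (sym (ℕ.+-suc x (suc t′))) (trans x+t≡D (sym x+1≡D)))))
  greedy x (suc t) x+t≡D closed bal | fixMove sx px
    with greedy (suc x) t (trans (sym (ℕ.+-suc x t)) x+t≡D) (closed-fix closed px) (balanced-fix bal sx px)
  ... | T , tiled = fix T , tiled-fix sx px tiled
  greedy x (suc t) x+t≡D closed bal | swapMove sx px sy py with t
  ... | zero   = ⊥-elim (ℕ.<-irrefl (trans (ℕ.+-comm 1 x) x+t≡D) (subst (_< D) px (p-< (<-of-+suc x+t≡D))))
  ... | suc t′ with greedy (suc (suc x)) t′ (trans (sym (trans (ℕ.+-suc x (suc t′)) (cong suc (ℕ.+-suc x t′)))) x+t≡D)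
                           (closed-swap closed px py) (balanced-swap bal sx px sy py)
  ...   | T , tiled = swap T , tiled-swap sx px sy py tiled

all-< : ∀ {P : ℕ → Set} → (∀ (i : Fin r) → P (toℕ i)) → ∀ {j} → j < r → P j
all-< {P = P} P-toℕ j<r = subst P (Fin.toℕ-fromℕ< j<r) (P-toℕ (fromℕ< j<r))

Represents : SignedPerm r → (ℕ → ℕ) → (ℕ → Bool) → Set
Represents {r} (π , σs) p s = ∀ (i : Fin r) → toℕ (lookup π i) ≡ p (toℕ i) × lookup σs i ≡ s (toℕ i)

extend : {A : Set} → A → (Fin m → A) → ℕ → A
extend {zero}  a f j       = a
extend {suc m} a f zero    = f zero
extend {suc m} a f (suc j) = extend a (f ∘ suc) j

extend-toℕ : ∀ {A : Set} (a : A) (f : Fin m → A) i → extend a f (toℕ i) ≡ f i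
extend-toℕ a f zero    = refl
extend-toℕ a f (suc i) = extend-toℕ a (f ∘ suc) i

permℕ : SignedPerm r → ℕ → ℕ
permℕ (π , _) = extend 0 (toℕ ∘ lookup π)

signℕ : SignedPerm r → ℕ → Bool
signℕ (_ , σs) = extend true (lookup σs)

represents-ℕ : ∀ (σ : SignedPerm r) → Represents σ (permℕ σ) (signℕ σ)
represents-ℕ (π , σs) i = sym (extend-toℕ 0 (toℕ ∘ lookup π) i) , sym (extend-toℕ true (lookup σs) i)

represents-< : ∀ (σ : SignedPerm r) {p s} → Represents σ p s → ∀ {j} → j < r → p j < r
represents-< (π , _) rep = all-< λ i → subst (_< _) (proj₁ (rep i)) (Fin.toℕ<n (lookup π i))

represents-injective : ∀ (σ : SignedPerm r) {p s} → InW σ → Represents σ p s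
                     → ∀ {j j′} → j < r → j′ < r → p j ≡ p j′ → j ≡ j′
represents-injective (π , σs) {p} w rep {j} {j′} j<r j′<r pj≡pj′ = begin
  j       ≡⟨ sym (Fin.toℕ-fromℕ< j<r) ⟩
  toℕ i   ≡⟨ cong toℕ (w i i′ (Fin.toℕ-injective (trans (at j<r) (trans pj≡pj′ (sym (at j′<r)))))) ⟩
  toℕ i′  ≡⟨ Fin.toℕ-fromℕ< j′<r ⟩
  j′      ∎
  where
  open ≡-Reasoning
  i = fromℕ< j<r
  i′ = fromℕ< j′<r
  at : ∀ {k} (k<r : k < _) → toℕ (lookup π (fromℕ< k<r)) ≡ p k
  at k<r = trans (proj₁ (rep (fromℕ< k<r))) (cong p (Fin.toℕ-fromℕ< k<r))

signedPerm : Tiling r → SignedPerm r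
signedPerm T = tabulate (λ i → fromℕ< (perm-< T (Fin.toℕ<n i))) , tabulate (sign T ∘ toℕ)

represents-signedPerm : ∀ (T : Tiling r) → Represents (signedPerm T) (perm T) (sign T)
represents-signedPerm T i =
  trans (cong toℕ (Vec.lookup∘tabulate _ i)) (Fin.toℕ-fromℕ< _) , Vec.lookup∘tabulate (sign T ∘ toℕ) i

represents⇒≡signedPerm : ∀ (σ : SignedPerm r) (T : Tiling r) → Represents σ (perm T) (sign T) → σ ≡ signedPerm T
represents⇒≡signedPerm (π , σs) T rep = cong₂ _,_
  (trans (sym (Vec.tabulate∘lookup π)) (Vec.tabulate-cong λ i →
     Fin.toℕ-injective (trans (proj₁ (rep i)) (sym (Fin.toℕ-fromℕ< _)))))
  (trans (sym (Vec.tabulate∘lookup σs)) (Vec.tabulate-cong (proj₂ ∘ rep)))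

signedPerm-InW : ∀ (T : Tiling r) → InW (signedPerm T)
signedPerm-InW T i i′ eq = Fin.toℕ-injective (begin
  toℕ i                      ≡⟨ sym (perm-involutive T (toℕ i)) ⟩
  perm T (perm T (toℕ i))    ≡⟨ cong (perm T) (trans (sym (proj₁ (rep i))) (trans (cong toℕ eq) (proj₁ (rep i′)))) ⟩
  perm T (perm T (toℕ i′))   ≡⟨ perm-involutive T (toℕ i′) ⟩
  toℕ i′                     ∎)
  where
  open ≡-Reasoning
  rep = represents-signedPerm T

signedPerm-injective : ∀ {T T′ : Tiling r} → signedPerm T ≡ signedPerm T′ → T ≡ T′
signedPerm-injective {T = T} {T′} eq = agree⇒≡ T T′ (all-< λ i →
  trans (sym (proj₁ (represents-signedPerm T i))) (trans (cong (λ σ → toℕ (lookup (proj₁ σ) i)) eq) (proj₁ (represents-signedPerm T′ i))) ,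
  trans (sym (proj₂ (represents-signedPerm T i))) (trans (cong (λ σ → lookup (proj₂ σ) i) eq) (proj₂ (represents-signedPerm T′ i))))

hasCard-image : ∀ {A : Set} {P : SignedPerm r → Set} (f : A → SignedPerm r) → (∀ {a b} → f a ≡ f b → a ≡ b)
  → (xs : List A) → Unique xs → (∀ a → a ∈ xs)
  → (∀ a → P (f a)) → (∀ σ → P σ → ∃ λ a → σ ≡ f a) → HasCard P (length xs)
hasCard-image {P = P} f f-injective xs unique complete P-image image-P =
  List.map f xs , Unique.map⁺ f-injective unique , (λ σ → mk⇔ (to σ) (from σ)) , List.length-map f xs
  where
  to : ∀ σ → σ ∈ List.map f xs → P σ
  to σ σ∈ with ∈-map⁻ f σ∈
  ... | a , _ , refl = P-image a
  from : ∀ σ → P σ → σ ∈ List.map f xs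
  from σ Pσ with image-P σ Pσ
  ... | a , refl = ∈-map⁺ f (complete a)

module Count (n a K : ℕ) where

  private
    d rank ℓ : ℕ
    d = suc (suc n)
    rank = suc d
    ℓ = a + K + K + 1

  λ₀ μ₀ : Wt rank
  λ₀ = ℓ · ϖ zero
  μ₀ = (a · ϖ zero) ⊕ (K · ϖ (suc zero))

  λℕ : ℕ → ℤ
  λℕ zero    = + ℓ
  λℕ (suc _) = + 0

  μℕ : ℕ → ℤ
  μℕ zero          = + (a + K)
  μℕ (suc zero)    = + K
  μℕ (suc (suc _)) = + 0

  λ₀+ρ : ∀ (m : Fin rank) → (λ₀ ⊕ ρ) m ≡ + 2 ℤ.* λℕ (toℕ m) ℤ.+ ρ-coord rank (toℕ m)
  λ₀+ρ zero    = cong₂ ℤ._+_ (ℤ.*-comm (+ ℓ) (+ 2)) (ρ-coordinate {rank} zero)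
  λ₀+ρ (suc m) = cong₂ ℤ._+_ (trans (ℤ.*-zeroʳ (+ ℓ)) (sym (ℤ.*-zeroʳ (+ 2)))) (ρ-coordinate {rank} (suc m))

  μ₀+ρ : ∀ (j : Fin rank) → (μ₀ ⊕ ρ) j ≡ + 2 ℤ.* μℕ (toℕ j) ℤ.+ ρ-coord rank (toℕ j)
  μ₀+ρ zero             = cong₂ ℤ._+_ (coeff (+ a) (+ K)) (ρ-coordinate {rank} zero)
    where
    coeff : ∀ x y → x ℤ.* + 2 ℤ.+ y ℤ.* + 2 ≡ + 2 ℤ.* (x ℤ.+ y)
    coeff = solve-∀
  μ₀+ρ (suc zero)       = cong₂ ℤ._+_ (coeff (+ a) (+ K)) (ρ-coordinate {rank} (suc zero))
    where
    coeff : ∀ x y → x ℤ.* + 0 ℤ.+ y ℤ.* + 2 ≡ + 2 ℤ.* y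
    coeff = solve-∀
  μ₀+ρ (suc (suc j))    = cong₂ ℤ._+_ (coeff (+ a) (+ K)) (ρ-coordinate {rank} (suc (suc j)))
    where
    coeff : ∀ x y → x ℤ.* + 0 ℤ.+ y ℤ.* + 0 ≡ + 2 ℤ.* + 0
    coeff = solve-∀

  -- ½(σ(λ₀ + ρ) − (μ₀ + ρ))_j when σ sends coordinate j to b times coordinate m
  η : Bool → ℕ → ℕ → ℤ
  η b m j = applySign b (λℕ m) ℤ.- μℕ j ℤ.+ excess rank b m j

  ηℕ : (ℕ → ℕ) → (ℕ → Bool) → ℕ → ℤ
  ηℕ p s j = η (s j) (p j) j

  ξ : SignedPerm rank → Wt rank
  ξ σ = act σ (λ₀ ⊕ ρ) ⊖ (μ₀ ⊕ ρ)

  ξ≡2η : ∀ σ {p s} → Represents σ p s → ∀ j → ξ σ j ≡ + 2 ℤ.* ηℕ p s (toℕ j)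
  ξ≡2η (π , σs) {p} {s} rep j = begin
    applySign b ((λ₀ ⊕ ρ) (lookup π j)) ℤ.- (μ₀ ⊕ ρ) j
      ≡⟨ cong₂ (λ u v → applySign b u ℤ.- v) (λ₀+ρ (lookup π j)) (μ₀+ρ j) ⟩
    applySign b (+ 2 ℤ.* λℕ k ℤ.+ ρ-coord rank k) ℤ.- (+ 2 ℤ.* μℕ (toℕ j) ℤ.+ ρ-coord rank (toℕ j))
      ≡⟨ applySign-ρ-coord b (λℕ k) (μℕ (toℕ j)) rank k (toℕ j) ⟩
    + 2 ℤ.* η b k (toℕ j)
      ≡⟨ cong₂ (λ b m → + 2 ℤ.* η b m (toℕ j)) (proj₂ (rep j)) (proj₁ (rep j)) ⟩
    + 2 ℤ.* ηℕ p s (toℕ j) ∎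
    where
    open ≡-Reasoning
    b = lookup σs j
    k = toℕ (lookup π j)

  ℘Pos-ξ⇔ : ∀ σ p s → Represents σ p s → ℘Pos (ξ σ) ⇔ (∀ i → i ≤ rank → + 0 ℤ.≤ Σ< (ηℕ p s) i)
  ℘Pos-ξ⇔ σ p s rep = mk⇔
    (λ ℘ξ i i≤r → subst (+ 0 ℤ.≤_) (prefix-toℕ (ηℕ p s) i≤r)
                    (℘Pos-double⇒0≤prefix (ηℕ p s ∘ toℕ) (℘Pos-cong (ξ≡2η σ {p} {s} rep) ℘ξ) i))
    (λ 0≤Σ → ℘Pos-cong (sym ∘ ξ≡2η σ {p} {s} rep) (0≤prefix⇒℘Pos-double (ηℕ p s ∘ toℕ)
                λ i i≤r → subst (+ 0 ℤ.≤_) (sym (prefix-toℕ (ηℕ p s) i≤r)) (0≤Σ i i≤r)))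

  η-away-from-0 : ∀ b {m} j → 1 ≤ m → η b m j ≡ ℤ.- μℕ j ℤ.+ excess rank b m j
  η-away-from-0 b j (s≤s _) = cong (ℤ._+ excess rank b _ j) (trans (cong (ℤ._- μℕ j) (applySign-0 b)) (ℤ.+-identityˡ (ℤ.- μℕ j)))

  Σ<-ηℕ : ∀ p s i → p 0 ≡ 0 → s 0 ≡ true → (∀ {j} → j ≤ i → 1 ≤ p (suc j))
        → Σ< (ηℕ p s) (suc (suc i)) ≡ + 1 ℤ.+ Σ< (excesses rank p s) (suc (suc i))
  Σ<-ηℕ p s i p0 s0 p≥1 = begin
    ηℕ p s 0 ℤ.+ (ηℕ p s 1 ℤ.+ Σ< (λ j → ηℕ p s (suc (suc j))) i)
      ≡⟨ cong₂ ℤ._+_ first (cong₂ ℤ._+_ (η-away-from-0 (s 1) 1 (p≥1 z≤n)) (Σ<-cong i rest)) ⟩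
    (+ ℓ ℤ.- + (a + K) ℤ.+ e 0) ℤ.+ ((ℤ.- + K ℤ.+ e 1) ℤ.+ Σ< (λ j → e (suc (suc j))) i)
      ≡⟨ rearrange (+ a) (+ K) (e 0) (e 1) (Σ< (λ j → e (suc (suc j))) i) ⟩
    + 1 ℤ.+ Σ< e (suc (suc i)) ∎
    where
    open ≡-Reasoning
    e = excesses rank p s
    first : ηℕ p s 0 ≡ + ℓ ℤ.- + (a + K) ℤ.+ e 0
    first rewrite p0 | s0 = refl
    rest : ∀ {j} → j < i → ηℕ p s (suc (suc j)) ≡ e (suc (suc j))
    rest {j} j<i = trans (η-away-from-0 (s (suc (suc j))) (suc (suc j)) (p≥1 j<i)) (ℤ.+-identityˡ (e (suc (suc j))))
    rearrange : ∀ A K e₀ e₁ X → A ℤ.+ K ℤ.+ K ℤ.+ + 1 ℤ.- (A ℤ.+ K) ℤ.+ e₀ ℤ.+ (ℤ.- K ℤ.+ e₁ ℤ.+ X)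
                              ≡ + 1 ℤ.+ (e₀ ℤ.+ (e₁ ℤ.+ X))
    rearrange = solve-∀

  first-coordinate : ∀ b m → m < rank → + 0 ℤ.≤ η b m 0 ℤ.+ + 0 → b ≡ true × m ≡ 0
  first-coordinate true  zero    _   _ = refl , refl
  first-coordinate false zero    _   h
    with 0≤x-y⇒y≤x {1} {rank + (rank + ℓ + (a + K))} (subst (+ 0 ℤ.≤_) (collect (+ ℓ) (+ (a + K)) (+ rank)) h)
    where
    collect : ∀ L A R → ℤ.- L ℤ.- A ℤ.+ (+ 0 ℤ.+ + 0 ℤ.+ + 1 ℤ.- (R ℤ.+ R)) ℤ.+ + 0 ≡ + 1 ℤ.- (R ℤ.+ (R ℤ.+ L ℤ.+ A))
    collect = solve-∀
  ... | s≤s ()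
  first-coordinate true  (suc m) _   h
    with 0≤x-y⇒y≤x {0} {suc m + (a + K)} (subst (+ 0 ℤ.≤_) (collect (+ (a + K)) (+ m)) h)
    where
    collect : ∀ A M → + 0 ℤ.- A ℤ.+ (+ 0 ℤ.- (+ 1 ℤ.+ M)) ℤ.+ + 0 ≡ + 0 ℤ.- (+ 1 ℤ.+ M ℤ.+ A)
    collect = solve-∀
  ... | ()
  first-coordinate false (suc m) m<r h = ⊥-elim (ℕ.<⇒≱ (ℕ.m<m+n rank (s≤s z≤n)) (ℕ.≤-trans 2r+A≤m+2 m<r))
    where
    collect : ∀ A M R → ℤ.- + 0 ℤ.- A ℤ.+ (+ 1 ℤ.+ M ℤ.+ + 0 ℤ.+ + 1 ℤ.- (R ℤ.+ R)) ℤ.+ + 0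
                      ≡ + 1 ℤ.+ (+ 1 ℤ.+ M) ℤ.- (R ℤ.+ (R ℤ.+ A))
    collect = solve-∀
    2r+A≤m+2 : rank + (rank + (a + K)) ≤ suc (suc m)
    2r+A≤m+2 = 0≤x-y⇒y≤x (subst (+ 0 ℤ.≤_) (collect (+ (a + K)) (+ m) (+ rank)) h)

  tiling⇒𝒜 : ∀ (T : Tiling d) → 𝒜 λ₀ μ₀ (signedPerm (fix T))
  tiling⇒𝒜 T = signedPerm-InW (fix T) , Equivalence.from (℘Pos-ξ⇔ (signedPerm (fix T)) (perm (fix T)) (sign (fix T)) (represents-signedPerm (fix T))) 0≤Ση
    where
    0≤Ση : ∀ i → i ≤ rank → + 0 ℤ.≤ Σ< (ηℕ (perm (fix T)) (sign (fix T))) i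
    0≤Ση zero          _   = +≤+ z≤n
    0≤Ση (suc zero)    _   = subst (+ 0 ℤ.≤_) (sym (surplus (+ a) (+ K))) (+≤+ z≤n)
      where
      surplus : ∀ A K → A ℤ.+ K ℤ.+ K ℤ.+ + 1 ℤ.- (A ℤ.+ K) ℤ.+ (+ 0 ℤ.- + 0) ℤ.+ + 0 ≡ K ℤ.+ + 1
      surplus = solve-∀
    0≤Ση (suc (suc i)) i≤r = subst (+ 0 ℤ.≤_) (sym (Σ<-ηℕ (perm (fix T)) (sign (fix T)) i refl refl (λ _ → s≤s z≤n)))
                                    (tiling-admissible (fix T) (suc (suc i)) i≤r)

  𝒜⇒tiling : ∀ σ → 𝒜 λ₀ μ₀ σ → ∃ λ (T : Tiling d) → σ ≡ signedPerm (fix T)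
  𝒜⇒tiling σ (w , ℘ξ) = T , represents⇒≡signedPerm σ (fix T) represents-fix
    where
    p = permℕ σ
    s = signℕ σ
    rep = represents-ℕ σ
    0≤Ση = Equivalence.to (℘Pos-ξ⇔ σ p s rep) ℘ξ
    p-< = represents-< σ {p} {s} rep
    p-injective = represents-injective σ {p} {s} w rep
    first = first-coordinate (s 0) (p 0) (p-< (s≤s z≤n)) (0≤Ση 1 (s≤s z≤n))
    s0 = proj₁ first
    p0 = proj₂ first
    closed : ∀ {y} → 1 ≤ y → y < rank → 1 ≤ p y
    closed {suc y} _ y<r = ℕ.≤∧≢⇒< z≤n λ 0≡py → ℕ.0≢1+n (p-injective (s≤s z≤n) y<r (trans p0 0≡py))
    balanced : Σ< (excesses rank p s) 1 ≡ + 0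
    balanced = cong₂ (λ b m → excess rank b m 0 ℤ.+ + 0) s0 p0
    admissible : Admissible rank p s
    admissible zero          _   = +≤+ z≤n
    admissible (suc zero)    _   = subst (λ x → + 0 ℤ.≤ + 1 ℤ.+ x) (sym balanced) (+≤+ z≤n)
    admissible (suc (suc i)) i≤r = subst (+ 0 ℤ.≤_) (Σ<-ηℕ p s i p0 s0 (λ j≤i → closed (s≤s z≤n) (ℕ.<-≤-trans (s≤s (s≤s j≤i)) i≤r)))
                                         (0≤Ση (suc (suc i)) i≤r)
    open Greedy {p = p} {s} p-< p-injective admissible using (greedy)
    tiling = greedy 1 d refl closed balanced
    T = proj₁ tiling
    represents-fix : Represents σ (perm (fix T)) (sign (fix T))
    represents-fix zero    = trans (proj₁ (rep zero)) p0 , trans (proj₂ (rep zero)) s0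
    represents-fix (suc i) = trans (proj₁ (rep (suc i))) (proj₁ (proj₂ tiling (Fin.toℕ<n i)))
                           , trans (proj₂ (rep (suc i))) (proj₂ (proj₂ tiling (Fin.toℕ<n i)))

  hasCard : HasCard (𝒜 λ₀ μ₀) (fib (suc (suc d)))
  hasCard = subst (HasCard (𝒜 λ₀ μ₀)) (length-tilings d)
    (hasCard-image (signedPerm ∘ fix) (fix-injective ∘ signedPerm-injective) (tilings d) (tilings-unique d) ∈-tilings
                   tiling⇒𝒜 𝒜⇒tiling)

corollary3p4 : (n : ℕ) → (ℓ k : ℕ) → ℓ % 2 ≡ 1 → 4 * k + 1 ≤ ℓ →
    HasCard {3 + n}
      (𝒜 (ℓ · ϖ zero) (((ℓ ∸ 1 ∸ 4 * k) · ϖ zero) ⊕ ((2 * k) · ϖ (suc zero))))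
      (fib (3 + n + 1))
corollary3p4 n ℓ k _ 4k+1≤ℓ =
  subst₂ (λ ℓ′ N → HasCard {3 + n} (𝒜 (ℓ′ · ϖ zero) ((a · ϖ zero) ⊕ ((2 * k) · ϖ (suc zero)))) N)
         ℓ≡ (cong (λ x → fib (3 + x)) (ℕ.+-comm 1 n)) (Count.hasCard n a (2 * k))
  where
  a = ℓ ∸ 1 ∸ 4 * k
  ℓ≡ : a + 2 * k + 2 * k + 1 ≡ ℓ
  ℓ≡ = begin
    a + 2 * k + 2 * k + 1  ≡⟨ cong (_+ 1) (trans (ℕ.+-assoc a (2 * k) (2 * k)) (cong (λ x → a + x) (double-double k))) ⟩
    a + 4 * k + 1          ≡⟨ cong (_+ 1) (ℕ.m∸n+n≡m (ℕ.m+n≤o⇒m≤o∸n (4 * k) 4k+1≤ℓ)) ⟩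
    ℓ ∸ 1 + 1              ≡⟨ ℕ.m∸n+n≡m (ℕ.≤-trans (ℕ.m≤n+m 1 (4 * k)) 4k+1≤ℓ) ⟩
    ℓ                      ∎
    where
    open ≡-Reasoning
    double-double : ∀ k → 2 * k + 2 * k ≡ 4 * k
    double-double = NatSolver.solve-∀
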